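{- Let $G$ be a graph with no isolated vertex, and let $v$ be a support vertex of $G$ that has exactly one neighbor $w$ that is not a leaf. Then there is a minimum disjunctive total dominating set of $G$ that contains $v$. Further, if $d_G(w) = 2$, then there is a minimum disjunctive total dominating set of $G$ that contains both $v$ and $w$.
   Context: A leaf is a vertex of degree $1$; a support vertex is a vertex adjacent to a leaf. A set $S \subseteq V(G)$ is a disjunctive total dominating set of $G$ if every vertex of $G$ either is adjacent to a vertex of $S$ or has at least two vertices of $S$ at distance exactly $2$ from it; a minimum such set is one of minimum cardinality. -}

module Defs where

open import Data.Nat using (ℕ; _≤_)
open import Data.Bool using (Bool; true; false; T)
open import Data.Fin using (Fin)
open import Data.Fin.Subset using (Subset; _∈_; ∣_∣)
open import Data.Vec using (countᵇ; allFin)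
open import Data.Product using (Σ; ∃; ∃-syntax; _×_)
open import Data.Sum using (_⊎_)
open import Relation.Nullary using (¬_)
open import Relation.Binary.PropositionalEquality using (_≡_)

record Graph (n : ℕ) : Set where
  field
    adj   : Fin n → Fin n → Bool
    sym   : ∀ u v → adj u v ≡ adj v u
    irref : ∀ v → adj v v ≡ false

module _ {n : ℕ} (G : Graph n) where
  open Graph G

  Adj : Fin n → Fin n → Set
  Adj u v = T (adj u v)

  degree : Fin n → ℕ
  degree v = countᵇ (adj v) (allFin n)

  IsolatedVertex : Fin n → Set
  IsolatedVertex v = ∀ u → ¬ Adj v u

  NoIsolatedVertex : Set
  NoIsolatedVertex = ∀ v → ¬ IsolatedVertex v

  Leaf : Fin n → Set
  Leaf v = degree v ≡ 1

  SupportVertex : Fin n → Set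
  SupportVertex v = ∃[ u ] (Adj v u × Leaf u)

  Dist2 : Fin n → Fin n → Set
  Dist2 u v = ¬ (u ≡ v) × ¬ Adj u v × ∃[ x ] (Adj u x × Adj x v)

  IsDTDSet : Subset n → Set
  IsDTDSet S = ∀ v →
      (∃[ u ] (u ∈ S × Adj v u))
    ⊎ (∃[ x ] ∃[ y ] (¬ (x ≡ y) × x ∈ S × y ∈ S × Dist2 v x × Dist2 v y))

  IsMinDTDSet : Subset n → Set
  IsMinDTDSet S = IsDTDSet S × (∀ T → IsDTDSet T → ∣ S ∣ ≤ ∣ T ∣)

module Submission where

-- Minimum disjunctive total dominating (DTD) sets exist, since
-- the whole vertex set is one (no isolated vertex) and DTD-ness is decidable.
-- The key tool is an exchange step: if x ∈ S is a leaf with neighbour p, then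
-- S - x ∪ {q} is again DTD provided p lies in it and has a neighbour in it;
-- the only vertex x dominated by adjacency is p, and any vertex at distance 2
-- from x is adjacent to p.  The new set is no larger, so minimality survives.
--   (1) If v ∉ S, the leaf ℓ at v has two S-vertices at distance 2, both
--       neighbours of v; at most one is the non-leaf w, so one is a leaf x,
--       and exchanging x for v puts v into S.
--   (2) If d(w) = 2, v ∈ S and w ∉ S, then v must have a neighbour u ∈ S
--       (two S-vertices at distance 2 from v would be neighbours of w besides
--       v, giving d(w) ≥ 3); u ≠ w is a leaf, and exchanging u for w keeps v.

open import Defs
open import Data.Nat using (ℕ; zero; suc; _≤_; _<_; _<?_; z≤n; s≤s; _+_; _≟_)
open import Data.Nat.Properties using (≤-trans; m≤n⇒m≤1+n; +-suc; +-comm; ≮⇒≥)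
open import Data.Nat.Induction using (<-wellFounded)
open import Induction.WellFounded using (Acc; acc)
open import Data.Bool using (Bool; true; false; T)
open import Data.Vec using ([]; _∷_; countᵇ; tabulate)
open import Data.Fin using (Fin; zero; suc; punchIn; punchOut)
import Data.Fin as Fin
open import Data.Fin.Properties using (any?; all?; punchIn-punchOut; punchOut-injective)
open import Data.Fin.Subset using (Subset; _∈_; ∣_∣; _∪_; _-_; ⁅_⁆; ⊤)
open import Data.Fin.Subset.Properties
  using (x∈p∪q⁺; x∈p∧x≢y⇒x∈p-y; x∈⁅x⁆; ∣⁅x⁆∣≡1; x∈p⇒∣p-x∣<∣p∣; anySubset?; _∈?_; ∈⊤)
open import Data.Product using (∃-syntax; _×_; _,_; proj₁)
open import Data.Sum using (_⊎_; inj₁; inj₂)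
open import Data.Empty using (⊥-elim)
open import Relation.Nullary using (¬_; Dec; yes; no)
open import Relation.Nullary.Decidable using (T?; _×-dec_; _⊎-dec_; ¬?)
open import Relation.Unary using (Decidable)
open import Relation.Binary.PropositionalEquality using (_≡_; _≢_; refl; sym; trans; cong; subst)
open import Function using (_∘_)

module Counting {a} {A : Set a} (f : A → Bool) where

  count : ∀ {n} → (Fin n → A) → ℕ
  count g = countᵇ f (tabulate g)

  count-punchIn : ∀ {n} (g : Fin (suc n) → A) i → T (f (g i)) →
                  count g ≡ suc (count (g ∘ punchIn i))
  count-punchIn g zero t with f (g zero)
  ... | true = refl
  count-punchIn {suc n} g (suc i) t with f (g zero)
  ... | true  = cong suc (count-punchIn (g ∘ suc) i t)
  ... | false = count-punchIn (g ∘ suc) i t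

  witness-punchOut : ∀ {n} (g : Fin (suc n) → A) {i j} (i≢j : i ≢ j) →
                     T (f (g j)) → T (f ((g ∘ punchIn i) (punchOut i≢j)))
  witness-punchOut g i≢j = subst (T ∘ f ∘ g) (sym (punchIn-punchOut i≢j))

  count-≥1 : ∀ {n} (g : Fin n → A) i → T (f (g i)) → 1 ≤ count g
  count-≥1 {suc n} g i ti = subst (1 ≤_) (sym (count-punchIn g i ti)) (s≤s z≤n)

  count-≥2 : ∀ {n} (g : Fin n → A) {i j} → i ≢ j →
             T (f (g i)) → T (f (g j)) → 2 ≤ count g
  count-≥2 {suc n} g {i} i≢j ti tj =
    subst (2 ≤_) (sym (count-punchIn g i ti))
      (s≤s (count-≥1 (g ∘ punchIn i) (punchOut i≢j) (witness-punchOut g i≢j tj)))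

  count-≥3 : ∀ {n} (g : Fin n → A) {i j k} → i ≢ j → i ≢ k → j ≢ k →
             T (f (g i)) → T (f (g j)) → T (f (g k)) → 3 ≤ count g
  count-≥3 {suc n} g {i} i≢j i≢k j≢k ti tj tk =
    subst (3 ≤_) (sym (count-punchIn g i ti))
      (s≤s (count-≥2 (g ∘ punchIn i) (j≢k ∘ punchOut-injective i≢j i≢k)
              (witness-punchOut g i≢j tj) (witness-punchOut g i≢k tk)))

∣p∪q∣≤∣p∣+∣q∣ : ∀ {n} (p q : Subset n) → ∣ p ∪ q ∣ ≤ ∣ p ∣ + ∣ q ∣
∣p∪q∣≤∣p∣+∣q∣ []          []          = z≤n
∣p∪q∣≤∣p∣+∣q∣ (true ∷ p)  (true ∷ q)  rewrite +-suc ∣ p ∣ ∣ q ∣ = s≤s (m≤n⇒m≤1+n (∣p∪q∣≤∣p∣+∣q∣ p q))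
∣p∪q∣≤∣p∣+∣q∣ (true ∷ p)  (false ∷ q) = s≤s (∣p∪q∣≤∣p∣+∣q∣ p q)
∣p∪q∣≤∣p∣+∣q∣ (false ∷ p) (true ∷ q)  rewrite +-suc ∣ p ∣ ∣ q ∣ = s≤s (∣p∪q∣≤∣p∣+∣q∣ p q)
∣p∪q∣≤∣p∣+∣q∣ (false ∷ p) (false ∷ q) = ∣p∪q∣≤∣p∣+∣q∣ p q

exchange : ∀ {n} → Subset n → Fin n → Fin n → Subset n
exchange S x q = (S - x) ∪ ⁅ q ⁆

∣exchange∣≤ : ∀ {n} (S : Subset n) {x} q → x ∈ S → ∣ exchange S x q ∣ ≤ ∣ S ∣
∣exchange∣≤ S {x} q x∈S = ≤-trans (∣p∪q∣≤∣p∣+∣q∣ (S - x) ⁅ q ⁆) bound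
  where
  bound : ∣ S - x ∣ + ∣ ⁅ q ⁆ ∣ ≤ ∣ S ∣
  bound rewrite ∣⁅x⁆∣≡1 q | +-comm ∣ S - x ∣ 1 = x∈p⇒∣p-x∣<∣p∣ x∈S

stays : ∀ {n} {S : Subset n} {x u} q → u ∈ S → u ≢ x → u ∈ exchange S x q
stays q u∈S u≢x = x∈p∪q⁺ (inj₁ (x∈p∧x≢y⇒x∈p-y u∈S u≢x))

enters : ∀ {n} (S : Subset n) x q → q ∈ exchange S x q
enters S x q = x∈p∪q⁺ (inj₂ (x∈⁅x⁆ q))

minimum-exists : ∀ {n} {P : Subset n → Set} → Decidable P →
                 ∀ T → P T → ∃[ S ] (P S × (∀ T → P T → ∣ S ∣ ≤ ∣ T ∣))
minimum-exists {P = P} P? T₀ PT₀ = descend T₀ (<-wellFounded ∣ T₀ ∣) PT₀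
  where
  descend : ∀ T → Acc _<_ ∣ T ∣ → P T → ∃[ S ] (P S × (∀ T → P T → ∣ S ∣ ≤ ∣ T ∣))
  descend T (acc smaller) PT with anySubset? (λ T' → P? T' ×-dec (∣ T' ∣ <? ∣ T ∣))
  ... | yes (T' , PT' , T'<T) = descend T' (smaller T'<T) PT'
  ... | no none = T , PT , λ T' PT' → ≮⇒≥ (λ T'<T → none (T' , PT' , T'<T))

module _ {n : ℕ} (G : Graph n) where

  adj-sym : ∀ {a b} → Adj G a b → Adj G b a
  adj-sym {a} {b} = subst T (Graph.sym G a b)

  adj-irrefl : ∀ {a} → ¬ Adj G a a
  adj-irrefl {a} = subst T (Graph.irref G a)

  Leaf? : ∀ x → Dec (Leaf G x)
  Leaf? x = degree G x ≟ 1

  leaf-neighbour-unique : ∀ {x a b} → Leaf G x → Adj G x a → Adj G x b → a ≡ b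
  leaf-neighbour-unique {x} {a} {b} leaf x~a x~b with a Fin.≟ b
  ... | yes a≡b = a≡b
  ... | no  a≢b with subst (2 ≤_) leaf (Counting.count-≥2 (Graph.adj G x) (λ u → u) a≢b x~a x~b)
  ...   | s≤s ()

  degree-≥3 : ∀ {x a b c} → a ≢ b → a ≢ c → b ≢ c →
              Adj G x a → Adj G x b → Adj G x c → 3 ≤ degree G x
  degree-≥3 {x} = Counting.count-≥3 (Graph.adj G x) (λ u → u)

  dist2-to-leaf : ∀ {x p z} → Leaf G x → Adj G x p → Dist2 G z x → Adj G z p
  dist2-to-leaf leaf x~p (_ , _ , c , z~c , c~x) =
    subst (Adj G _) (leaf-neighbour-unique leaf (adj-sym c~x) x~p) z~c

  dist2-from-leaf : ∀ {ℓ v x} → Leaf G ℓ → Adj G ℓ v → Dist2 G ℓ x → Adj G v x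
  dist2-from-leaf leaf ℓ~v (_ , _ , c , ℓ~c , c~x) =
    subst (λ c → Adj G c _) (leaf-neighbour-unique leaf ℓ~c ℓ~v) c~x

  DTDAt : Subset n → Fin n → Set
  DTDAt S z = (∃[ u ] (u ∈ S × Adj G z u))
            ⊎ (∃[ x ] ∃[ y ] (x ≢ y × x ∈ S × y ∈ S × Dist2 G z x × Dist2 G z y))

  IsDTDSet? : ∀ S → Dec (IsDTDSet G S)
  IsDTDSet? S = all? λ z →
      any? (λ u → (u ∈? S) ×-dec Adj? z u)
    ⊎-dec any? (λ x → any? λ y →
      ¬? (x Fin.≟ y) ×-dec (x ∈? S) ×-dec (y ∈? S) ×-dec Dist2? z x ×-dec Dist2? z y)
    where
    Adj? : ∀ a b → Dec (Adj G a b)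
    Adj? a b = T? (Graph.adj G a b)
    Dist2? : ∀ z x → Dec (Dist2 G z x)
    Dist2? z x = ¬? (z Fin.≟ x) ×-dec ¬? (Adj? z x) ×-dec any? (λ c → Adj? z c ×-dec Adj? c x)

  -- Without isolated vertices every vertex has a neighbour in V(G), so a
  -- minimum DTD set exists.
  minimum-DTD-exists : NoIsolatedVertex G → ∃[ S ] IsMinDTDSet G S
  minimum-DTD-exists no-isolated = minimum-exists IsDTDSet? ⊤ whole-set
    where
    whole-set : IsDTDSet G ⊤
    whole-set z with any? (λ u → T? (Graph.adj G z u))
    ... | yes (u , z~u) = inj₁ (u , ∈⊤ , z~u)
    ... | no  none      = ⊥-elim (no-isolated z (λ u z~u → none (u , z~u)))

  exchange-DTD : ∀ {S x p} q → IsDTDSet G S → Leaf G x → Adj G x p →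
                 p ∈ exchange S x q → ∃[ u ] (u ∈ exchange S x q × Adj G p u) →
                 IsDTDSet G (exchange S x q)
  exchange-DTD {S} {x} {p} q dtd leaf x~p p∈S' p-dominated z = redo (dtd z)
    where
    via-p : Dist2 G z x → ∃[ u ] (u ∈ exchange S x q × Adj G z u)
    via-p d = p , p∈S' , dist2-to-leaf leaf x~p d
    redo : DTDAt S z → DTDAt (exchange S x q) z
    redo (inj₁ (u , u∈S , z~u)) with u Fin.≟ x
    ... | yes refl = inj₁ (subst (λ z → ∃[ u ] (u ∈ exchange S x q × Adj G z u))
                                 (leaf-neighbour-unique leaf x~p (adj-sym z~u)) p-dominated)
    ... | no  u≢x  = inj₁ (u , stays q u∈S u≢x , z~u)
    redo (inj₂ (a , b , a≢b , a∈S , b∈S , da , db)) with a Fin.≟ x | b Fin.≟ x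
    ... | yes refl | _        = inj₁ (via-p da)
    ... | no  _    | yes refl = inj₁ (via-p db)
    ... | no  a≢x  | no  b≢x  = inj₂ (a , b , a≢b , stays q a∈S a≢x , stays q b∈S b≢x , da , db)

  exchange-leaf : ∀ {S x p r} q → IsMinDTDSet G S → x ∈ S → Leaf G x → Adj G x p →
                  p ∈ exchange S x q → r ∈ exchange S x q → Adj G p r →
                  IsMinDTDSet G (exchange S x q)
  exchange-leaf {S} {r = r} q (dtd , minimal) x∈S leaf x~p p∈S' r∈S' p~r =
    exchange-DTD q dtd leaf x~p p∈S' (r , r∈S' , p~r) ,
    λ T dtdT → ≤-trans (∣exchange∣≤ S q x∈S) (minimal T dtdT)

  adj-≢ : ∀ {a b} → Adj G a b → a ≢ b
  adj-≢ a~b refl = adj-irrefl a~b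

module OnlyNonLeafNeighbour {n : ℕ} (G : Graph n) (v w : Fin n)
         (only-w : ∀ u → Adj G v u → ¬ Leaf G u → u ≡ w) where

  one-is-leaf : ∀ {x y} → Adj G v x → Adj G v y → x ≢ y → Leaf G x ⊎ Leaf G y
  one-is-leaf {x} {y} v~x v~y x≢y with Leaf? G x | Leaf? G y
  ... | yes leaf-x | _          = inj₁ leaf-x
  ... | no  _      | yes leaf-y = inj₂ leaf-y
  ... | no  ¬leaf-x | no ¬leaf-y =
    ⊥-elim (x≢y (trans (only-w x v~x ¬leaf-x) (sym (only-w y v~y ¬leaf-y))))

  -- If v ∉ S, the leaf ℓ at v sees two S-vertices at distance 2, which are
  -- neighbours of v; exchanging the one that is a leaf for v puts v into S.
  with-v : ∀ {ℓ} → Adj G v ℓ → Leaf G ℓ → ∀ S → IsMinDTDSet G S →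
           ∃[ S' ] (IsMinDTDSet G S' × v ∈ S')
  with-v {ℓ} v~ℓ leaf-ℓ S min with v ∈? S
  ... | yes v∈S = S , min , v∈S
  ... | no  v∉S = move-v-in (proj₁ min ℓ)
    where
    near-v : ∀ {z} → Dist2 G ℓ z → Adj G v z
    near-v = dist2-from-leaf G leaf-ℓ (adj-sym G v~ℓ)

    exchange-for-v : ∀ {x y} → Leaf G x → x ∈ S → y ∈ S → y ≢ x → Adj G v x → Adj G v y →
                     ∃[ S' ] (IsMinDTDSet G S' × v ∈ S')
    exchange-for-v {x} leaf-x x∈S y∈S y≢x v~x v~y =
      exchange S x v ,
      exchange-leaf G v min x∈S leaf-x (adj-sym G v~x) (enters S x v) (stays v y∈S y≢x) v~y ,
      enters S x v

    move-v-in : DTDAt G S ℓ → ∃[ S' ] (IsMinDTDSet G S' × v ∈ S')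
    move-v-in (inj₁ (u , u∈S , ℓ~u)) =
      ⊥-elim (v∉S (subst (_∈ S) (leaf-neighbour-unique G leaf-ℓ ℓ~u (adj-sym G v~ℓ)) u∈S))
    move-v-in (inj₂ (x , y , x≢y , x∈S , y∈S , ℓ-x , ℓ-y))
      with one-is-leaf (near-v ℓ-x) (near-v ℓ-y) x≢y
    ... | inj₁ leaf-x = exchange-for-v leaf-x x∈S y∈S (x≢y ∘ sym) (near-v ℓ-x) (near-v ℓ-y)
    ... | inj₂ leaf-y = exchange-for-v leaf-y y∈S x∈S x≢y (near-v ℓ-y) (near-v ℓ-x)

  -- A vertex at distance 2 from v is reached through a non-leaf, i.e. through w.
  dist2-from-v : ∀ {a} → Dist2 G v a → Adj G w a
  dist2-from-v {a} (v≢a , _ , c , v~c , c~a) with Leaf? G c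
  ... | yes leaf-c = ⊥-elim (v≢a (leaf-neighbour-unique G leaf-c (adj-sym G v~c) c~a))
  ... | no ¬leaf-c = subst (λ c → Adj G c a) (only-w c v~c ¬leaf-c) c~a

  -- When d(w) = 2, v cannot be dominated by two vertices at distance 2
  -- (they and v would be three neighbours of w), so it has a neighbour in S.
  v-has-neighbour : degree G w ≡ 2 → Adj G v w → ∀ {S} → IsDTDSet G S →
                    ∃[ u ] (u ∈ S × Adj G v u)
  v-has-neighbour deg-w v~w dtd with dtd v
  ... | inj₁ neighbour = neighbour
  ... | inj₂ (a , b , a≢b , _ , _ , v-a , v-b)
        with subst (3 ≤_) deg-w (degree-≥3 G (proj₁ v-a) (proj₁ v-b) a≢b
                                  (adj-sym G v~w) (dist2-from-v v-a) (dist2-from-v v-b))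
  ...   | s≤s (s≤s ())

  -- If d(w) = 2 and v ∈ S but w ∉ S, the neighbour of v in S is a leaf;
  -- exchanging it for w keeps v and adds w.
  with-v-and-w : degree G w ≡ 2 → Adj G v w → ∀ S → IsMinDTDSet G S → v ∈ S →
                 ∃[ S' ] (IsMinDTDSet G S' × v ∈ S' × w ∈ S')
  with-v-and-w deg-w v~w S min v∈S with w ∈? S
  ... | yes w∈S = S , min , v∈S , w∈S
  ... | no  w∉S with v-has-neighbour deg-w v~w (proj₁ min)
  ...   | u , u∈S , v~u with Leaf? G u
  ...     | no ¬leaf-u = ⊥-elim (w∉S (subst (_∈ S) (only-w u v~u ¬leaf-u) u∈S))
  ...     | yes leaf-u =
            exchange S u w ,
            exchange-leaf G w min u∈S leaf-u (adj-sym G v~u) v∈S' (enters S u w) v~w ,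
            v∈S' , enters S u w
    where
    v∈S' : v ∈ exchange S u w
    v∈S' = stays w v∈S (adj-≢ G v~u)

-- Start from any minimum DTD set, move v in, then (if d(w) = 2) move w in.
lemmal : {n : ℕ} (G : Graph n) → NoIsolatedVertex G →
    (v w : Fin n) → SupportVertex G v →
    Adj G v w → ¬ Leaf G w →
    (∀ u → Adj G v u → ¬ Leaf G u → u ≡ w) →
    (∃[ S ] (IsMinDTDSet G S × v ∈ S))
    × (degree G w ≡ 2 → ∃[ S ] (IsMinDTDSet G S × v ∈ S × w ∈ S))
lemmal G no-isolated v w (ℓ , v~ℓ , leaf-ℓ) v~w _ only-w = containing-v , containing-v-and-w
  where
  open OnlyNonLeafNeighbour G v w only-w

  containing-v : ∃[ S ] (IsMinDTDSet G S × v ∈ S)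
  containing-v with minimum-DTD-exists G no-isolated
  ... | S , min = with-v v~ℓ leaf-ℓ S min

  containing-v-and-w : degree G w ≡ 2 → ∃[ S ] (IsMinDTDSet G S × v ∈ S × w ∈ S)
  containing-v-and-w deg-w with containing-v
  ... | S , min , v∈S = with-v-and-w deg-w v~w S min v∈S
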